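{- Let $a,b$ be integers with $1 \le a \le b$, and let $i \ge 1$ and $r \ge 1$ be integers. Then $n(a,b;r) \le n(a+i,b+2i;r)$, and consequently $\mathrm{dor}(a,b) \ge \mathrm{dor}(a+i,b+2i)$.
   Context: For integers $1 \le a \le b$, an $(a,b)$-triple is a triple $(x, ax+d, bx+2d)$ with $x,d$ positive integers. A coloring admits a monochromatic $(a,b)$-triple if all three entries of some $(a,b)$-triple receive the same color. For $r\ge 1$, $n(a,b;r)$ denotes the least positive integer $n$ such that every $r$-coloring of $\{1,\dots,n\}$ admits a monochromatic $(a,b)$-triple, with $n(a,b;r)=\infty$ if no such $n$ exists. The pair $(a,b)$ is $r$-regular if every $r$-coloring of $\mathbb{N}$ admits a monochromatic $(a,b)$-triple, and regular if it is $r$-regular for every $r \in \mathbb{N}$. The degree of regularity $\mathrm{dor}(a,b)$ is the largest $r$ such that $(a,b)$ is $r$-regular, and $\mathrm{dor}(a,b)=\infty$ if $(a,b)$ is regular. -}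

module Defs where

open import Data.Nat using (ℕ; suc; _+_; _*_; _≤_)
open import Data.Fin using (Fin)
open import Data.Product using (Σ; _×_)
open import Relation.Binary.PropositionalEquality using (_≡_)

-- An r-coloring is a function ℕ → Fin r (only values on positive integers,
-- resp. on {1,…,n}, matter).

MonoTripleUpTo : (a b : ℕ) {r : ℕ} → (ℕ → Fin r) → ℕ → Set
MonoTripleUpTo a b c n =
  Σ ℕ λ x → Σ ℕ λ d →
    1 ≤ x × 1 ≤ d × x ≤ n × a * x + d ≤ n × b * x + 2 * d ≤ n ×
    c x ≡ c (a * x + d) × c x ≡ c (b * x + 2 * d)

MonoTriple : (a b : ℕ) {r : ℕ} → (ℕ → Fin r) → Set
MonoTriple a b c =
  Σ ℕ λ x → Σ ℕ λ d →
    1 ≤ x × 1 ≤ d ×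
    c x ≡ c (a * x + d) × c x ≡ c (b * x + 2 * d)

Forces : (a b r n : ℕ) → Set
Forces a b r n = (c : ℕ → Fin r) → MonoTripleUpTo a b c n

-- IsN a b r n : n = n(a,b;r) (finite), i.e. n is the least positive
-- integer with Forces a b r n.  n(a,b;r) = ∞ iff no n satisfies IsN.
IsN : (a b r n : ℕ) → Set
IsN a b r n = 1 ≤ n × Forces a b r n × ((m : ℕ) → 1 ≤ m → Forces a b r m → n ≤ m)

RRegular : (a b r : ℕ) → Set
RRegular a b r = (c : ℕ → Fin r) → MonoTriple a b c

Regular : (a b : ℕ) → Set
Regular a b = (r : ℕ) → 1 ≤ r → RRegular a b r

IsDor : (a b d : ℕ) → Set
IsDor a b d = RRegular a b d × ((r : ℕ) → RRegular a b r → r ≤ d)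

{-# OPTIONS --safe #-}
-- Since (a + i) x + d = a x + (i x + d) and (b + 2i) x + 2d = b x + 2(i x + d),
-- the (a+i, b+2i)-triple with parameters (x, d) is, entry by entry, the
-- (a, b)-triple with parameters (x, i x + d).  So every coloring forcing the
-- former forces the latter, which gives both inequalities.  To obtain
-- n(a,b;r) constructively as a least element, "every r-coloring of {1,…,n}
-- admits a monochromatic triple" is decided: it only depends on the colors of
-- 0,…,n, so it reduces to a finite search over those.
module Submission where

open import Defs
open import Data.Nat using (ℕ; zero; suc; _+_; _*_; _≤_; _<_; s≤s; _≤?_)
open import Data.Nat.Properties using (≤-refl; ≤-trans; <⇒≤; ≮⇒≥; m≤n+m; anyUpTo?)
open import Data.Nat.Induction using (<-wellFounded)
open import Data.Nat.Tactic.RingSolver using (solve-∀)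
open import Data.Fin using (Fin)
import Data.Fin.Properties as Fin
open import Data.Product using (Σ; _×_; _,_)
open import Function using (_∘_)
open import Induction.WellFounded using (Acc; acc)
open import Relation.Nullary using (Dec; yes; no)
open import Relation.Nullary.Decidable using (_×-dec_; map′)
open import Relation.Unary using (Decidable)
open import Relation.Binary.PropositionalEquality using (_≡_; refl; sym; trans; cong; subst)

second-entry-shift : ∀ a i x d → a * x + (i * x + d) ≡ (a + i) * x + d
second-entry-shift = solve-∀

third-entry-shift : ∀ b i x d → b * x + 2 * (i * x + d) ≡ (b + 2 * i) * x + 2 * d
third-entry-shift = solve-∀

monoTripleUpTo-shift : ∀ a b i {r} {c : ℕ → Fin r} {n} →
  MonoTripleUpTo (a + i) (b + 2 * i) c n → MonoTripleUpTo a b c n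
monoTripleUpTo-shift a b i {c = c} {n}
  (x , d , 1≤x , 1≤d , x≤n , ax+d≤n , bx+2d≤n , mono₁ , mono₂) =
  x , i * x + d , 1≤x , ≤-trans 1≤d (m≤n+m d (i * x)) , x≤n ,
  subst (_≤ n) (sym (second-entry-shift a i x d)) ax+d≤n ,
  subst (_≤ n) (sym (third-entry-shift b i x d)) bx+2d≤n ,
  trans mono₁ (cong c (sym (second-entry-shift a i x d))) ,
  trans mono₂ (cong c (sym (third-entry-shift b i x d)))

monoTriple-shift : ∀ a b i {r} {c : ℕ → Fin r} →
  MonoTriple (a + i) (b + 2 * i) c → MonoTriple a b c
monoTriple-shift a b i {c = c} (x , d , 1≤x , 1≤d , mono₁ , mono₂) =
  x , i * x + d , 1≤x , ≤-trans 1≤d (m≤n+m d (i * x)) ,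
  trans mono₁ (cong c (sym (second-entry-shift a i x d))) ,
  trans mono₂ (cong c (sym (third-entry-shift b i x d)))

forces-shift : ∀ a b i {r n} → Forces (a + i) (b + 2 * i) r n → Forces a b r n
forces-shift a b i forces c = monoTripleUpTo-shift a b i (forces c)

rRegular-shift : ∀ a b i {r} → RRegular (a + i) (b + 2 * i) r → RRegular a b r
rRegular-shift a b i regular c = monoTriple-shift a b i (regular c)

Exhaustible : Set → Set₁
Exhaustible A = ∀ {Q : A → Set} → Decidable Q → Dec (∀ v → Q v)

DeterminedBelow : {A : Set} → ℕ → ((ℕ → A) → Set) → Set
DeterminedBelow N P = ∀ {c c'} → (∀ {k} → k < N → c k ≡ c' k) → P c → P c'

_∷ᶜ_ : {A : Set} → A → (ℕ → A) → ℕ → A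
(v ∷ᶜ c) zero    = v
(v ∷ᶜ c) (suc k) = c k

∷ᶜ-η : {A : Set} (c : ℕ → A) → ∀ {k} → (c 0 ∷ᶜ (c ∘ suc)) k ≡ c k
∷ᶜ-η c {zero}  = refl
∷ᶜ-η c {suc k} = refl

∷ᶜ-agree : {A : Set} {N : ℕ} (v : A) {c c' : ℕ → A} →
  (∀ {k} → k < N → c k ≡ c' k) → ∀ {k} → k < suc N → (v ∷ᶜ c) k ≡ (v ∷ᶜ c') k
∷ᶜ-agree v agree {zero}  _         = refl
∷ᶜ-agree v agree {suc k} (s≤s k<N) = agree k<N

∀-determinedBelow? : {A : Set} → Exhaustible A → ∀ N {P : (ℕ → A) → Set} →
  Decidable P → DeterminedBelow N P → Dec (∀ c → P c)
∀-determinedBelow? all? zero P? determined =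
  map′ (λ P-const c → determined (λ ()) (P-const (c 0)))
       (λ P-all v → P-all (λ _ → v))
       (all? (λ v → P? (λ _ → v)))
∀-determinedBelow? all? (suc N) P? determined =
  map′ (λ P-cons c → determined (λ _ → ∷ᶜ-η c) (P-cons (c ∘ suc) (c 0)))
       (λ P-all c v → P-all (v ∷ᶜ c))
       (∀-determinedBelow? all? N (λ c → all? (λ v → P? (v ∷ᶜ c)))
                           (λ agree P-cons v → determined (∷ᶜ-agree v agree) (P-cons v)))

monoTripleUpTo-determinedBelow : ∀ a b {r} n →
  DeterminedBelow (suc n) (λ (c : ℕ → Fin r) → MonoTripleUpTo a b c n)
monoTripleUpTo-determinedBelow a b n agree
  (x , d , 1≤x , 1≤d , x≤n , ax+d≤n , bx+2d≤n , mono₁ , mono₂) =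
  x , d , 1≤x , 1≤d , x≤n , ax+d≤n , bx+2d≤n ,
  trans (sym (agree (s≤s x≤n))) (trans mono₁ (agree (s≤s ax+d≤n))) ,
  trans (sym (agree (s≤s x≤n))) (trans mono₂ (agree (s≤s bx+2d≤n)))

monoTripleUpTo? : ∀ a b {r} (c : ℕ → Fin r) n → Dec (MonoTripleUpTo a b c n)
monoTripleUpTo? a b c n =
  map′ (λ (x , _ , d , _ , triple) → x , d , triple)
       (λ (x , d , triple@(_ , _ , x≤n , ax+d≤n , _)) →
          x , s≤s x≤n , d , s≤s (≤-trans (m≤n+m d (a * x)) ax+d≤n) , triple)
       (anyUpTo? (λ x → anyUpTo? (λ d → triple? x d) (suc n)) (suc n))
  where
  triple? : ∀ x d → Dec (1 ≤ x × 1 ≤ d × x ≤ n × a * x + d ≤ n × b * x + 2 * d ≤ n ×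
                         c x ≡ c (a * x + d) × c x ≡ c (b * x + 2 * d))
  triple? x d = 1 ≤? x ×-dec 1 ≤? d ×-dec x ≤? n ×-dec a * x + d ≤? n ×-dec
                b * x + 2 * d ≤? n ×-dec c x Fin.≟ c (a * x + d) ×-dec
                c x Fin.≟ c (b * x + 2 * d)

forces? : ∀ a b r n → Dec (Forces a b r n)
forces? a b r n =
  ∀-determinedBelow? Fin.all? (suc n) (λ c → monoTripleUpTo? a b c n)
                     (monoTripleUpTo-determinedBelow a b n)

least-below : {P : ℕ → Set} → Decidable P → ∀ {n} → P n →
  Σ ℕ λ m → P m × (∀ k → P k → m ≤ k) × m ≤ n
least-below {P} P? {n} = search n (<-wellFounded n)
  where
  search : ∀ n → Acc _<_ n → P n → Σ ℕ λ m → P m × (∀ k → P k → m ≤ k) × m ≤ n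
  search n (acc smaller) Pn with anyUpTo? P? n
  ... | yes (k , k<n , Pk) =
    let m , Pm , least , m≤k = search k (smaller k<n) Pk
    in  m , Pm , least , ≤-trans m≤k (<⇒≤ k<n)
  ... | no none = n , Pn , (λ k Pk → ≮⇒≥ (λ k<n → none (k , k<n , Pk))) , ≤-refl

isN-below : ∀ a b r {n} → 1 ≤ n → Forces a b r n → Σ ℕ λ m → IsN a b r m × m ≤ n
isN-below a b r 1≤n forces
  with least-below (λ k → 1 ≤? k ×-dec forces? a b r k) (1≤n , forces)
... | m , (1≤m , forces-m) , least , m≤n =
  m , (1≤m , forces-m , λ k 1≤k forces-k → least k (1≤k , forces-k)) , m≤n

lemma1 : (a b i r : ℕ) → 1 ≤ a → a ≤ b → 1 ≤ i → 1 ≤ r →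
    -- n(a,b;r) ≤ n(a+i,b+2i;r)
    ((m' : ℕ) → IsN (a + i) (b + 2 * i) r m' → Σ ℕ λ m → IsN a b r m × m ≤ m')
    ×
    -- dor(a,b) ≥ dor(a+i,b+2i)
    ((Regular (a + i) (b + 2 * i) → Regular a b)
     × ((d d₀ : ℕ) → IsDor (a + i) (b + 2 * i) d → IsDor a b d₀ → d ≤ d₀))
lemma1 a b i r _ _ _ _ =
  (λ m' (1≤m' , forces , _) → isN-below a b r 1≤m' (forces-shift a b i forces)) ,
  (λ regular s 1≤s → rRegular-shift a b i (regular s 1≤s)) ,
  (λ d d₀ (regular-d , _) (_ , maximal) → maximal d (rRegular-shift a b i regular-d))
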